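{- For positive integers $k\ge \ell$, $b_{k, \ell}\ge \left\lfloor\frac{k}{\ell}\right\rfloor$.
   Context: Let $H_{n,k}=\{0,1,\dots,n-1\}^k$. For $\ell\le k$, an $\ell$-rook is a point $P\in H_{n,k}$ together with a set $D$ of $\ell$ of the $k$ coordinate indices; it attacks every point of $H_{n,k}$ which differs from $P$ in exactly one coordinate, that coordinate belonging to $D$. Distinct rooks must occupy distinct points. $b_{n,k,\ell}$ is the maximum number of $\ell$-rooks that can be placed in $H_{n,k}$ so that no rook attacks the position of another rook, and $b_{k,\ell}=\lim_{n\to\infty} b_{n,k,\ell}/n^{k-1}$ (this limit exists). -}

module Defs where

open import Data.Nat using (ℕ)
open import Data.Fin using (Fin)
open import Data.Fin.Subset using (Subset; _∈_; ∣_∣)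
open import Data.Vec using (Vec; lookup)
open import Data.List using (List; map; length)
open import Data.List.Relation.Unary.All using (All)
open import Data.List.Relation.Unary.Unique.Propositional using (Unique)
open import Data.Product using (Σ; _×_; proj₁)
open import Relation.Binary.PropositionalEquality using (_≡_; _≢_)
open import Relation.Nullary using (¬_)

Point : ℕ → ℕ → Set
Point n k = Vec (Fin n) k

record Rook (n k ℓ : ℕ) : Set where
  constructor rook
  field
    pos  : Point n k
    dirs : Subset k
    card : ∣ dirs ∣ ≡ ℓ
open Rook public

Attacks : ∀ {n k ℓ} → Rook n k ℓ → Point n k → Set
Attacks {k = k} r Q =
  Σ (Fin k) λ i →
    (i ∈ dirs r) × (lookup (pos r) i ≢ lookup Q i)
      × (∀ (j : Fin k) → j ≢ i → lookup (pos r) j ≡ lookup Q j)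

NonAttacking : ∀ {n k ℓ} → List (Rook n k ℓ) → Set
NonAttacking rs =
  Unique (map pos rs) × All (λ r → All (λ s → ¬ Attacks r (pos s)) rs) rs

-- Write k = qℓ + r with q = ⌊k/ℓ⌋ and cut the first qℓ coordinates into q blocks of length ℓ.
-- A block is a codeword when its first entry is the sum mod n of the others; two codewords never
-- differ in exactly one coordinate. For each j < q put a rook moving along block j on every point
-- whose block j is a codeword and whose other blocks are not. A move along block j keeps every
-- other block, so it cannot reach a point of another class (that point has a codeword where the
-- mover has none), and it cannot reach a point of class j (block j would be a codeword before and
-- after a one-coordinate change). Each class has n^(ℓ-1) (n^(ℓ-1) (n-1))^(q-1) n^r points, so there
-- are q n^(k-1) (1 - 1/n)^(q-1) ≥ q n^(k-1) (1 - (q-1)/n) rooks by Bernoulli's inequality, which is at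
-- least (q - 1/m) n^(k-1) as soon as n ≥ q (q-1) m.

module Submission where

open import Defs
open import Data.Nat using (ℕ; zero; suc; _+_; _*_; _^_; _∸_; _≤_; _<_; s≤s; NonZero; >-nonZero)
open import Data.Nat.Properties
  using (m+[n∸m]≡n; +-assoc; +-comm; +-identityʳ; *-assoc; *-comm; m≤m+n; n≤1+n; m≤n⇒m≤1+n;
         +-monoʳ-≤; +-monoˡ-≤; *-monoʳ-≤; *-monoˡ-≤; *-cancelʳ-≤; ^-monoˡ-≤; ^-distribˡ-+-*; ^-*-assoc;
         module ≤-Reasoning)
open import Data.Nat.DivMod
  using (_%_; _/_; m%n<n; m%n≤n; m%n%n≡m%n; m<n⇒m%n≡m; %-distribˡ-+; [m+kn]%n≡m%n; m≡m%n+[m/n]*n; m≥n⇒m/n>0)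
open import Data.Nat.Tactic.RingSolver using (solve-∀)
open import Data.Fin using (Fin; zero; suc; toℕ; fromℕ<; punchIn)
open import Data.Fin.Properties
  using (toℕ-fromℕ<; toℕ-injective; toℕ<n; suc-injective; punchInᵢ≢i; punchIn-injective)
open import Data.Fin.Subset using (Subset; _∈_; ∣_∣; ⊤; ⊥; inside; outside)
open import Data.Fin.Subset.Properties using (∉⊥; ∣⊤∣≡n; ∣⊥∣≡0)
open import Data.Vec using (Vec; []; _∷_; _++_; concat; lookup; here; there)
open import Data.Vec.Relation.Unary.All as VecAll using (All; []; _∷_)
open import Data.Vec.Properties using (++-injectiveˡ; ++-injectiveʳ; ∷-injective; ∷-injectiveʳ)
open import Data.Vec.Relation.Binary.Pointwise.Extensional using (ext; Pointwise-≡⇒≡)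
open import Data.List as List using (List; length; allFin; cartesianProductWith)
open import Data.List.Properties using (length-++; length-map; length-tabulate; concat-map; map-∘; map-id; map-cong)
open import Data.List.Membership.Propositional using () renaming (_∈_ to _∈ₗ_)
open import Data.List.Membership.Propositional.Properties
  using (∈-map⁻; ∈-cartesianProductWith⁻; ∈-concat⁻′)
open import Data.List.Relation.Unary.All as ListAll using ()
open import Data.List.Relation.Unary.All.Properties as ListAllₚ using ()
open import Data.List.Relation.Unary.AllPairs as AllPairs using ()
open import Data.List.Relation.Unary.AllPairs.Properties as AllPairsₚ using ()
open import Data.List.Relation.Unary.Unique.Propositional using (Unique)
open import Data.List.Relation.Unary.Unique.Propositional.Properties
  using (map⁺; concat⁺; cartesianProductWith⁺; allFin⁺)
open import Data.List.Relation.Binary.Disjoint.Propositional using (Disjoint)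
open import Data.Product using (Σ; _×_; _,_; ∃₂)
open import Data.Sum using (_⊎_; inj₁; inj₂)
open import Data.Empty using (⊥-elim)
open import Function using (_∘_; id)
open import Relation.Binary.PropositionalEquality
open import Relation.Nullary using (¬_)

%-cancelˡ-< : ∀ a {b c n} .{{_ : NonZero n}} → b < n → c < n → (a + b) % n ≡ (a + c) % n → b ≡ c
%-cancelˡ-< a {b} {c} {n} b<n c<n eq = begin
  b                             ≡⟨ m<n⇒m%n≡m b<n ⟨
  b % n                         ≡⟨ undo b ⟨
  ((a + b) % n + e) % n         ≡⟨ cong (λ t → (t + e) % n) eq ⟩
  ((a + c) % n + e) % n         ≡⟨ undo c ⟩
  c % n                         ≡⟨ m<n⇒m%n≡m c<n ⟩
  c                             ∎
  where
  open ≡-Reasoning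
  e = n ∸ a % n
  undo : ∀ x → ((a + x) % n + e) % n ≡ x % n
  undo x = begin
    ((a + x) % n + e) % n           ≡⟨ %-distribˡ-+ ((a + x) % n) e n ⟩
    ((a + x) % n % n + e % n) % n   ≡⟨ cong (λ t → (t + e % n) % n) (m%n%n≡m%n (a + x) n) ⟩
    ((a + x) % n + e % n) % n       ≡⟨ %-distribˡ-+ (a + x) e n ⟨
    (a + x + e) % n                 ≡⟨ cong (_% n) (begin
      a + x + e                       ≡⟨ cong (λ t → t + x + e) (m≡m%n+[m/n]*n a n) ⟩
      a % n + a / n * n + x + e       ≡⟨ regroup (a % n) (a / n * n) x e ⟩
      x + (a % n + e) + a / n * n     ≡⟨ cong (λ t → x + t + a / n * n) (m+[n∸m]≡n (m%n≤n a n)) ⟩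
      x + n + a / n * n               ≡⟨ +-assoc x n (a / n * n) ⟩
      x + suc (a / n) * n             ∎) ⟩
    (x + suc (a / n) * n) % n       ≡⟨ [m+kn]%n≡m%n x (suc (a / n)) n ⟩
    x % n                           ∎
    where
    regroup : ∀ r d x e → r + d + x + e ≡ x + (r + e) + d
    regroup = solve-∀

^-distrib-* : ∀ a b p → (a * b) ^ p ≡ a ^ p * b ^ p
^-distrib-* a b zero    = refl
^-distrib-* a b (suc p) = trans (cong (a * b *_) (^-distrib-* a b p)) (interchange a b (a ^ p) (b ^ p))
  where
  interchange : ∀ a b c d → a * b * (c * d) ≡ a * c * (b * d)
  interchange = solve-∀

^-bernoulli : ∀ n p → suc n ^ p * suc n ≤ n ^ p * suc n + p * suc n ^ p
^-bernoulli n zero    = m≤m+n (1 * suc n) 0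
^-bernoulli n (suc p) = begin
  suc n * A * suc n                         ≡⟨ *-assoc (suc n) A (suc n) ⟩
  suc n * (A * suc n)                       ≤⟨ *-monoʳ-≤ (suc n) (^-bernoulli n p) ⟩
  suc n * (B * suc n + p * A)               ≡⟨ expand n B A p ⟩
  n * B * suc n + (B * suc n + p * (suc n * A))
    ≤⟨ +-monoʳ-≤ (n * B * suc n) (+-monoˡ-≤ (p * (suc n * A)) B*[1+n]≤A*[1+n]) ⟩
  n * B * suc n + (A * suc n + p * (suc n * A)) ≡⟨ collect n B A p ⟩
  n * B * suc n + suc p * (suc n * A)       ∎
  where
  open ≤-Reasoning
  A = suc n ^ p
  B = n ^ p
  B*[1+n]≤A*[1+n] : B * suc n ≤ A * suc n
  B*[1+n]≤A*[1+n] = *-monoˡ-≤ (suc n) (^-monoˡ-≤ p (n≤1+n n))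
  expand : ∀ n B A p → suc n * (B * suc n + p * A) ≡ n * B * suc n + (B * suc n + p * (suc n * A))
  expand = solve-∀
  collect : ∀ n B A p → n * B * suc n + (A * suc n + p * (suc n * A)) ≡ n * B * suc n + suc p * (suc n * A)
  collect = solve-∀

^-gap : ∀ c n p → c * p ≤ n → c * suc n ^ p ≤ c * n ^ p + suc n ^ p
^-gap c n p cp≤n = *-cancelʳ-≤ (c * A) (c * B + A) (suc n) (begin
  c * A * suc n              ≡⟨ *-assoc c A (suc n) ⟩
  c * (A * suc n)            ≤⟨ *-monoʳ-≤ c (^-bernoulli n p) ⟩
  c * (B * suc n + p * A)    ≡⟨ expand c B (suc n) p A ⟩
  c * B * suc n + c * p * A  ≤⟨ +-monoʳ-≤ (c * B * suc n) (*-monoˡ-≤ A (m≤n⇒m≤1+n cp≤n)) ⟩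
  c * B * suc n + suc n * A  ≡⟨ collect c B (suc n) A ⟩
  (c * B + A) * suc n        ∎)
  where
  open ≤-Reasoning
  A = suc n ^ p
  B = n ^ p
  expand : ∀ c B a p A → c * (B * a + p * A) ≡ c * B * a + c * p * A
  expand = solve-∀
  collect : ∀ c B a A → c * B * a + a * A ≡ (c * B + A) * a
  collect = solve-∀

length-cartesianProductWith : ∀ {A B C : Set} (f : A → B → C) xs ys →
                              length (cartesianProductWith f xs ys) ≡ length xs * length ys
length-cartesianProductWith f List.[]       ys = refl
length-cartesianProductWith f (x List.∷ xs) ys = begin
  length (List.map (f x) ys List.++ cartesianProductWith f xs ys)
    ≡⟨ length-++ (List.map (f x) ys) ⟩
  length (List.map (f x) ys) + length (cartesianProductWith f xs ys)
    ≡⟨ cong₂ _+_ (length-map (f x) ys) (length-cartesianProductWith f xs ys) ⟩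
  length ys + length xs * length ys
    ∎
  where open ≡-Reasoning

length-allFin : ∀ m → length (allFin m) ≡ m
length-allFin m = length-tabulate id

length-concat-map : ∀ {A B : Set} (f : A → List B) {c} → (∀ x → length (f x) ≡ c) →
                    ∀ xs → length (List.concat (List.map f xs)) ≡ length xs * c
length-concat-map f len List.[]       = refl
length-concat-map f len (x List.∷ xs) =
  trans (length-++ (f x)) (cong₂ _+_ (len x) (length-concat-map f len xs))

module _ {A : Set} where

  vectors : List A → ∀ t → List (Vec A t)
  vectors xs zero    = List.[ [] ]
  vectors xs (suc t) = cartesianProductWith _∷_ xs (vectors xs t)

  ∈-vectors⁻ : ∀ {xs t} {v : Vec A t} → v ∈ₗ vectors xs t → All (_∈ₗ xs) v
  ∈-vectors⁻ {t = zero}  {[]} _ = []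
  ∈-vectors⁻ {xs} {suc t} v∈ with ∈-cartesianProductWith⁻ _∷_ xs (vectors xs t) v∈
  ... | _ , _ , x∈ , v′∈ , refl = x∈ ∷ ∈-vectors⁻ v′∈

  vectors-unique : ∀ {xs} t → Unique xs → Unique (vectors xs t)
  vectors-unique zero    _  = ListAll.[] AllPairs.∷ AllPairs.[]
  vectors-unique (suc t) u = cartesianProductWith⁺ _∷_ ∷-injective u (vectors-unique t u)

  length-vectors : ∀ xs t → length (vectors xs t) ≡ length xs ^ t
  length-vectors xs zero    = refl
  length-vectors xs (suc t) =
    trans (length-cartesianProductWith _∷_ xs (vectors xs t)) (cong (length xs *_) (length-vectors xs t))

concat-injective : ∀ {A : Set} {q m} (bs cs : Vec (Vec A m) q) → concat bs ≡ concat cs → bs ≡ cs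
concat-injective []       []       _  = refl
concat-injective (b ∷ bs) (c ∷ cs) eq =
  cong₂ _∷_ (++-injectiveˡ b c eq) (concat-injective bs cs (++-injectiveʳ b c eq))

∣p++q∣≡∣p∣+∣q∣ : ∀ {s t} (p : Subset s) (q : Subset t) → ∣ p ++ q ∣ ≡ ∣ p ∣ + ∣ q ∣
∣p++q∣≡∣p∣+∣q∣ []            q = refl
∣p++q∣≡∣p∣+∣q∣ (inside ∷ p)  q = cong suc (∣p++q∣≡∣p∣+∣q∣ p q)
∣p++q∣≡∣p∣+∣q∣ (outside ∷ p) q = ∣p++q∣≡∣p∣+∣q∣ p q

-- Attacks r Q unfolds to AttacksAlong (dirs r) (pos r) Q.
AttacksAlong : ∀ {A : Set} {t} → Subset t → Vec A t → Vec A t → Set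
AttacksAlong {t = t} D P Q =
  Σ (Fin t) λ i → (i ∈ D) × (lookup P i ≢ lookup Q i) × (∀ j → j ≢ i → lookup P j ≡ lookup Q j)

module _ {A : Set} where

  attacksAlong-here : ∀ {t} {D : Subset t} {x y} {P : Vec A t} →
                      x ≢ y → AttacksAlong (inside ∷ D) (x ∷ P) (y ∷ P)
  attacksAlong-here x≢y = zero , here , x≢y , λ { zero 0≢0 → ⊥-elim (0≢0 refl) ; (suc j) _ → refl }

  attacksAlong-there : ∀ {t d} {D : Subset t} {x} {P Q : Vec A t} →
                       AttacksAlong D P Q → AttacksAlong (d ∷ D) (x ∷ P) (x ∷ Q)
  attacksAlong-there (i , i∈ , Pᵢ≢Qᵢ , same) =
    suc i , there i∈ , Pᵢ≢Qᵢ , λ { zero _ → refl ; (suc j) j≢i → same j (j≢i ∘ cong suc) }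

  attacksAlong-∷⁻ : ∀ {t d} {D : Subset t} {x y} {P Q : Vec A t} → AttacksAlong (d ∷ D) (x ∷ P) (y ∷ Q) →
                    (d ≡ inside × x ≢ y × P ≡ Q) ⊎ (x ≡ y × AttacksAlong D P Q)
  attacksAlong-∷⁻ (zero , here , x≢y , same) =
    inj₁ (refl , x≢y , Pointwise-≡⇒≡ (ext λ j → same (suc j) λ ()))
  attacksAlong-∷⁻ (suc i , there i∈ , Pᵢ≢Qᵢ , same) =
    inj₂ (same zero (λ ()) , i , i∈ , Pᵢ≢Qᵢ , λ j j≢i → same (suc j) (j≢i ∘ suc-injective))

  attacksAlong-++⁻ : ∀ {s t} (D : Subset s) {E : Subset t} (P Q : Vec A s) {P′ Q′ : Vec A t} →
                     AttacksAlong (D ++ E) (P ++ P′) (Q ++ Q′) →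
                     (AttacksAlong D P Q × P′ ≡ Q′) ⊎ (P ≡ Q × AttacksAlong E P′ Q′)
  attacksAlong-++⁻ [] [] [] att = inj₂ (refl , att)
  attacksAlong-++⁻ (d ∷ D) (x ∷ P) (y ∷ Q) att with attacksAlong-∷⁻ att
  ... | inj₁ (refl , x≢y , eq) =
        inj₁ (subst (λ R → AttacksAlong _ (x ∷ P) (y ∷ R)) (++-injectiveˡ P Q eq) (attacksAlong-here x≢y) ,
              ++-injectiveʳ P Q eq)
  ... | inj₂ (refl , att′) with attacksAlong-++⁻ D P Q att′
  ...   | inj₁ (attᴾ , eq) = inj₁ (attacksAlong-there attᴾ , eq)
  ...   | inj₂ (refl , attᴱ) = inj₂ (refl , attᴱ)

module _ {n : ℕ} where

  infixl 6 _⊕_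
  _⊕_ : Fin (suc n) → Fin (suc n) → Fin (suc n)
  x ⊕ y = fromℕ< (m%n<n (toℕ x + toℕ y) (suc n))

  toℕ-⊕ : ∀ x y → toℕ (x ⊕ y) ≡ (toℕ x + toℕ y) % suc n
  toℕ-⊕ x y = toℕ-fromℕ< (m%n<n (toℕ x + toℕ y) (suc n))

  ⊕-comm : ∀ x y → x ⊕ y ≡ y ⊕ x
  ⊕-comm x y = toℕ-injective (begin
    toℕ (x ⊕ y)               ≡⟨ toℕ-⊕ x y ⟩
    (toℕ x + toℕ y) % suc n   ≡⟨ cong (_% suc n) (+-comm (toℕ x) (toℕ y)) ⟩
    (toℕ y + toℕ x) % suc n   ≡⟨ toℕ-⊕ y x ⟨
    toℕ (y ⊕ x)               ∎)
    where open ≡-Reasoning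

  ⊕-cancelˡ : ∀ x {y z} → x ⊕ y ≡ x ⊕ z → y ≡ z
  ⊕-cancelˡ x {y} {z} eq = toℕ-injective (%-cancelˡ-< (toℕ x) (toℕ<n y) (toℕ<n z)
    (trans (sym (toℕ-⊕ x y)) (trans (cong toℕ eq) (toℕ-⊕ x z))))

  ⊕-cancelʳ : ∀ {x y} z → x ⊕ z ≡ y ⊕ z → x ≡ y
  ⊕-cancelʳ {x} {y} z eq = ⊕-cancelˡ z (trans (⊕-comm z x) (trans eq (⊕-comm y z)))

  checksum : ∀ {t} → Vec (Fin (suc n)) t → Fin (suc n)
  checksum []      = zero
  checksum (x ∷ P) = x ⊕ checksum P

  IsCodeword : ∀ {t} → Vec (Fin (suc n)) (suc t) → Set
  IsCodeword (x ∷ P) = x ≡ checksum P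

  checksum-attacked : ∀ {t} {D : Subset t} {P Q} → AttacksAlong D P Q → checksum P ≢ checksum Q
  checksum-attacked {D = _ ∷ _} {x ∷ P} {y ∷ Q} att with attacksAlong-∷⁻ att
  ... | inj₁ (_ , x≢y , refl) = x≢y ∘ ⊕-cancelʳ (checksum P)
  ... | inj₂ (refl , att′)    = checksum-attacked {P = P} {Q} att′ ∘ ⊕-cancelˡ x

  codewords-far : ∀ {t} {D : Subset (suc t)} {P Q} → IsCodeword P → IsCodeword Q → ¬ AttacksAlong D P Q
  codewords-far {D = _ ∷ _} {x ∷ P} {y ∷ Q} cP cQ att with attacksAlong-∷⁻ att
  ... | inj₁ (_ , x≢y , refl) = x≢y (trans cP (sym cQ))
  ... | inj₂ (refl , att′)    = checksum-attacked {P = P} {Q} att′ (trans (sym cP) cQ)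

blockDirs : ∀ {q m} → Fin q → Subset (q * m)
blockDirs {suc q} {m} zero    = ⊤ {m} ++ ⊥
blockDirs {suc q} {m} (suc j) = ⊥ {m} ++ blockDirs j

∣blockDirs∣ : ∀ {q m} (j : Fin q) → ∣ blockDirs {m = m} j ∣ ≡ m
∣blockDirs∣ {suc q} {m} zero =
  trans (∣p++q∣≡∣p∣+∣q∣ (⊤ {m}) ⊥) (trans (cong₂ _+_ (∣⊤∣≡n m) (∣⊥∣≡0 (q * m))) (+-identityʳ m))
∣blockDirs∣ {suc q} {m} (suc j) =
  trans (∣p++q∣≡∣p∣+∣q∣ (⊥ {m}) (blockDirs j)) (cong₂ _+_ (∣⊥∣≡0 m) (∣blockDirs∣ j))

module BlockCode (n-1 ℓ-1 r : ℕ) where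

  n ℓ : ℕ
  n = suc n-1
  ℓ = suc ℓ-1

  Block : Set
  Block = Vec (Fin n) ℓ

  NonCodeword : Block → Set
  NonCodeword b = ¬ IsCodeword b

  OnlyCodewordAt : ∀ {q} → Fin q → Vec Block q → Set
  OnlyCodewordAt zero    (b ∷ bs) = IsCodeword b × All NonCodeword bs
  OnlyCodewordAt (suc j) (b ∷ bs) = NonCodeword b × OnlyCodewordAt j bs

  noCodeword⇒¬onlyCodewordAt : ∀ {q} {bs : Vec Block q} (j : Fin q) → All NonCodeword bs → ¬ OnlyCodewordAt j bs
  noCodeword⇒¬onlyCodewordAt zero    (nc ∷ _)   (c , _)  = nc c
  noCodeword⇒¬onlyCodewordAt (suc j) (_  ∷ ncs) (_ , oc) = noCodeword⇒¬onlyCodewordAt j ncs oc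

  onlyCodewordAt-unique : ∀ {q} {bs : Vec Block q} (j i : Fin q) →
                          OnlyCodewordAt j bs → OnlyCodewordAt i bs → j ≡ i
  onlyCodewordAt-unique              zero    zero    _        _        = refl
  onlyCodewordAt-unique {bs = _ ∷ _} zero    (suc i) (c , _)  (nc , _) = ⊥-elim (nc c)
  onlyCodewordAt-unique {bs = _ ∷ _} (suc j) zero    (nc , _) (c , _)  = ⊥-elim (nc c)
  onlyCodewordAt-unique {bs = _ ∷ _} (suc j) (suc i) (_ , oj) (_ , oi) = cong suc (onlyCodewordAt-unique j i oj oi)

  onlyCodewordAt-far : ∀ {q} (j i : Fin q) {bs cs : Vec Block q} → OnlyCodewordAt j bs → OnlyCodewordAt i cs →
                       ¬ AttacksAlong (blockDirs j) (concat bs) (concat cs)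
  onlyCodewordAt-far zero zero {b ∷ _} {c ∷ _} (cb , _) (cc , _) att with attacksAlong-++⁻ ⊤ b c att
  ... | inj₁ (attᵇ , _) = codewords-far cb cc attᵇ
  ... | inj₂ (_ , _ , i∈⊥ , _) = ∉⊥ i∈⊥
  onlyCodewordAt-far zero (suc i) {b ∷ bs} {c ∷ cs} (_ , ncs) (_ , oi) att with attacksAlong-++⁻ ⊤ b c att
  ... | inj₁ (_ , eq) =
        noCodeword⇒¬onlyCodewordAt i ncs (subst (OnlyCodewordAt i) (sym (concat-injective bs cs eq)) oi)
  ... | inj₂ (_ , _ , i∈⊥ , _) = ∉⊥ i∈⊥
  onlyCodewordAt-far (suc j) zero {b ∷ _} {c ∷ _} (nb , _) (cc , _) att with attacksAlong-++⁻ ⊥ b c att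
  ... | inj₁ ((_ , i∈⊥ , _) , _) = ∉⊥ i∈⊥
  ... | inj₂ (refl , _) = nb cc
  onlyCodewordAt-far (suc j) (suc i) {b ∷ _} {c ∷ _} (_ , oj) (_ , oi) att with attacksAlong-++⁻ ⊥ b c att
  ... | inj₁ ((_ , i∈⊥ , _) , _) = ∉⊥ i∈⊥
  ... | inj₂ (_ , att′) = onlyCodewordAt-far j i oj oi att′

  length-allVectors : ∀ t → length (vectors (allFin n) t) ≡ n ^ t
  length-allVectors t = trans (length-vectors (allFin n) t) (cong (_^ t) (length-allFin n))

  codewords : List Block
  codewords = List.map (λ P → checksum P ∷ P) (vectors (allFin n) ℓ-1)

  -- punchIn (checksum P) ranges over the n-1 heads other than checksum P.
  nonCodewords : List Block
  nonCodewords = cartesianProductWith (λ P x → punchIn (checksum P) x ∷ P) (vectors (allFin n) ℓ-1) (allFin n-1)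

  ∈-codewords⁻ : ∀ {b} → b ∈ₗ codewords → IsCodeword b
  ∈-codewords⁻ b∈ with ∈-map⁻ (λ P → checksum P ∷ P) b∈
  ... | _ , _ , refl = refl

  ∈-nonCodewords⁻ : ∀ {b} → b ∈ₗ nonCodewords → NonCodeword b
  ∈-nonCodewords⁻ b∈ with ∈-cartesianProductWith⁻ _ (vectors (allFin n) ℓ-1) (allFin n-1) b∈
  ... | P , x , _ , _ , refl = punchInᵢ≢i (checksum P) x

  codewords-unique : Unique codewords
  codewords-unique = map⁺ ∷-injectiveʳ (vectors-unique ℓ-1 (allFin⁺ n))

  nonCodewords-unique : Unique nonCodewords
  nonCodewords-unique = cartesianProductWith⁺ _ injective (vectors-unique ℓ-1 (allFin⁺ n)) (allFin⁺ n-1)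
    where
    injective : ∀ {P Q x y} → punchIn (checksum P) x ∷ P ≡ punchIn (checksum Q) y ∷ Q → P ≡ Q × x ≡ y
    injective {P} eq with ∷-injective eq
    ... | head , refl = refl , punchIn-injective (checksum P) _ _ head

  length-codewords : length codewords ≡ n ^ ℓ-1
  length-codewords = trans (length-map _ (vectors (allFin n) ℓ-1)) (length-allVectors ℓ-1)

  length-nonCodewords : length nonCodewords ≡ n ^ ℓ-1 * n-1
  length-nonCodewords = trans (length-cartesianProductWith _ (vectors (allFin n) ℓ-1) (allFin n-1))
    (cong₂ _*_ (length-allVectors ℓ-1) (length-allFin n-1))

  blocksAt : ∀ {q} → Fin q → List (Vec Block q)
  blocksAt {suc q} zero    = cartesianProductWith _∷_ codewords (vectors nonCodewords q)
  blocksAt {suc q} (suc j) = cartesianProductWith _∷_ nonCodewords (blocksAt j)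

  ∈-blocksAt⁻ : ∀ {q} (j : Fin q) {bs} → bs ∈ₗ blocksAt j → OnlyCodewordAt j bs
  ∈-blocksAt⁻ {suc q} zero bs∈ with ∈-cartesianProductWith⁻ _∷_ codewords (vectors nonCodewords q) bs∈
  ... | _ , _ , b∈ , bs∈′ , refl = ∈-codewords⁻ b∈ , VecAll.map ∈-nonCodewords⁻ (∈-vectors⁻ bs∈′)
  ∈-blocksAt⁻ {suc q} (suc j) bs∈ with ∈-cartesianProductWith⁻ _∷_ nonCodewords (blocksAt j) bs∈
  ... | _ , _ , b∈ , bs∈′ , refl = ∈-nonCodewords⁻ b∈ , ∈-blocksAt⁻ j bs∈′

  blocksAt-unique : ∀ {q} (j : Fin q) → Unique (blocksAt j)
  blocksAt-unique {suc q} zero    =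
    cartesianProductWith⁺ _∷_ ∷-injective codewords-unique (vectors-unique q nonCodewords-unique)
  blocksAt-unique {suc q} (suc j) =
    cartesianProductWith⁺ _∷_ ∷-injective nonCodewords-unique (blocksAt-unique j)

  length-blocksAt : ∀ {q} (j : Fin (suc q)) → length (blocksAt j) ≡ n ^ ℓ-1 * (n ^ ℓ-1 * n-1) ^ q
  length-blocksAt {q} zero = begin
    length (blocksAt {suc q} zero)                     ≡⟨ length-cartesianProductWith _∷_ codewords (vectors nonCodewords q) ⟩
    length codewords * length (vectors nonCodewords q) ≡⟨ cong₂ _*_ length-codewords (length-vectors nonCodewords q) ⟩
    n ^ ℓ-1 * length nonCodewords ^ q                  ≡⟨ cong (λ d → n ^ ℓ-1 * d ^ q) length-nonCodewords ⟩
    n ^ ℓ-1 * (n ^ ℓ-1 * n-1) ^ q                      ∎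
    where open ≡-Reasoning
  length-blocksAt {suc q} (suc j) = begin
    length (blocksAt (suc j))                 ≡⟨ length-cartesianProductWith _∷_ nonCodewords (blocksAt j) ⟩
    length nonCodewords * length (blocksAt j) ≡⟨ cong₂ _*_ length-nonCodewords (length-blocksAt j) ⟩
    d * (n ^ ℓ-1 * d ^ q)                     ≡⟨ x*[y*z]≡y*[x*z] d (n ^ ℓ-1) (d ^ q) ⟩
    n ^ ℓ-1 * (d * d ^ q)                     ∎
    where
    open ≡-Reasoning
    d = n ^ ℓ-1 * n-1
    x*[y*z]≡y*[x*z] : ∀ x y z → x * (y * z) ≡ y * (x * z)
    x*[y*z]≡y*[x*z] = solve-∀

  positionsAt : ∀ {q} → Fin q → List (Point n (q * ℓ + r))
  positionsAt j = cartesianProductWith (λ bs z → concat bs ++ z) (blocksAt j) (vectors (allFin n) r)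

  ∈-positionsAt⁻ : ∀ {q} (j : Fin q) {P} → P ∈ₗ positionsAt j →
                   ∃₂ λ bs z → OnlyCodewordAt j bs × P ≡ concat bs ++ z
  ∈-positionsAt⁻ j P∈ with ∈-cartesianProductWith⁻ _ (blocksAt j) (vectors (allFin n) r) P∈
  ... | bs , z , bs∈ , _ , eq = bs , z , ∈-blocksAt⁻ j bs∈ , eq

  concat++-injective : ∀ {q} {bs cs : Vec Block q} {z z′ : Vec (Fin n) r} →
                       concat bs ++ z ≡ concat cs ++ z′ → bs ≡ cs × z ≡ z′
  concat++-injective {bs = bs} {cs} eq =
    concat-injective bs cs (++-injectiveˡ (concat bs) (concat cs) eq) , ++-injectiveʳ (concat bs) (concat cs) eq

  positionsAt-unique : ∀ {q} (j : Fin q) → Unique (positionsAt j)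
  positionsAt-unique j = cartesianProductWith⁺ _ concat++-injective (blocksAt-unique j) (vectors-unique r (allFin⁺ n))

  positionsAt-disjoint : ∀ {q} {j i : Fin q} → j ≢ i → Disjoint (positionsAt j) (positionsAt i)
  positionsAt-disjoint {j = j} {i} j≢i (P∈ʲ , P∈ⁱ) with ∈-positionsAt⁻ j P∈ʲ | ∈-positionsAt⁻ i P∈ⁱ
  ... | bs , _ , oj , refl | cs , _ , oi , eq with concat++-injective {bs = bs} {cs} eq
  ...   | refl , _ = j≢i (onlyCodewordAt-unique j i oj oi)

  length-positionsAt : ∀ {q} (j : Fin (suc q)) → length (positionsAt j) ≡ n ^ ℓ-1 * (n ^ ℓ-1 * n-1) ^ q * n ^ r
  length-positionsAt j = trans (length-cartesianProductWith _ (blocksAt j) (vectors (allFin n) r))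
    (cong₂ _*_ (length-blocksAt j) (length-allVectors r))

  rookAt : ∀ {q} → Fin q → Point n (q * ℓ + r) → Rook n (q * ℓ + r) ℓ
  rookAt j P = rook P (blockDirs j ++ ⊥) (begin
    ∣ blockDirs j ++ ⊥ ∣          ≡⟨ ∣p++q∣≡∣p∣+∣q∣ (blockDirs j) ⊥ ⟩
    ∣ blockDirs j ∣ + ∣ ⊥ {r} ∣   ≡⟨ cong₂ _+_ (∣blockDirs∣ j) (∣⊥∣≡0 r) ⟩
    ℓ + 0                         ≡⟨ +-identityʳ ℓ ⟩
    ℓ                             ∎)
    where open ≡-Reasoning

  rookAt-harmless : ∀ {q} {j i : Fin q} {P Q} → P ∈ₗ positionsAt j → Q ∈ₗ positionsAt i → ¬ Attacks (rookAt j P) Q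
  rookAt-harmless {j = j} {i} P∈ Q∈ att with ∈-positionsAt⁻ j P∈ | ∈-positionsAt⁻ i Q∈
  ... | bs , _ , oj , refl | cs , _ , oi , refl with attacksAlong-++⁻ (blockDirs j) (concat bs) (concat cs) att
  ...   | inj₁ (attᵇ , _)         = onlyCodewordAt-far j i oj oi attᵇ
  ...   | inj₂ (_ , _ , i∈⊥ , _) = ∉⊥ i∈⊥

  rooksAt : ∀ {q} → Fin q → List (Rook n (q * ℓ + r) ℓ)
  rooksAt j = List.map (rookAt j) (positionsAt j)

  rooks : ∀ q → List (Rook n (q * ℓ + r) ℓ)
  rooks q = List.concat (List.map rooksAt (allFin q))

  ∈-rooks⁻ : ∀ {q} {ρ : Rook n (q * ℓ + r) ℓ} → ρ ∈ₗ rooks q → ∃₂ λ j P → P ∈ₗ positionsAt j × ρ ≡ rookAt j P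
  ∈-rooks⁻ {q} ρ∈ with ∈-concat⁻′ (List.map rooksAt (allFin q)) ρ∈
  ... | _ , ρ∈ʲ , js∈ with ∈-map⁻ rooksAt js∈
  ...   | j , _ , refl with ∈-map⁻ (rookAt j) ρ∈ʲ
  ...     | P , P∈ , eq = j , P , P∈ , eq

  map-pos-rooks : ∀ q → List.map pos (rooks q) ≡ List.concat (List.map positionsAt (allFin q))
  map-pos-rooks q = begin
    List.map pos (List.concat (List.map rooksAt (allFin q)))
      ≡⟨ concat-map (List.map rooksAt (allFin q)) ⟨
    List.concat (List.map (List.map pos) (List.map rooksAt (allFin q)))
      ≡⟨ cong List.concat (map-∘ (allFin q)) ⟨
    List.concat (List.map (List.map pos ∘ rooksAt) (allFin q))
      ≡⟨ cong List.concat (map-cong pos-rooksAt (allFin q)) ⟩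
    List.concat (List.map positionsAt (allFin q))
      ∎
    where
    open ≡-Reasoning
    pos-rooksAt : ∀ j → List.map pos (rooksAt j) ≡ positionsAt j
    pos-rooksAt j = trans (sym (map-∘ (positionsAt j))) (map-id (positionsAt j))

  rooks-harmless : ∀ {q} {ρ σ : Rook n (q * ℓ + r) ℓ} → ρ ∈ₗ rooks q → σ ∈ₗ rooks q → ¬ Attacks ρ (pos σ)
  rooks-harmless {q} ρ∈ σ∈ with ∈-rooks⁻ {q} ρ∈ | ∈-rooks⁻ {q} σ∈
  ... | j , _ , P∈ , refl | i , _ , Q∈ , refl = rookAt-harmless {j = j} {i} P∈ Q∈

  rooks-nonAttacking : ∀ q → NonAttacking (rooks q)
  rooks-nonAttacking q = subst Unique (sym (map-pos-rooks q)) positions-unique ,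
                         ListAll.tabulate λ ρ∈ → ListAll.tabulate λ σ∈ → rooks-harmless {q} ρ∈ σ∈
    where
    positions-unique : Unique (List.concat (List.map positionsAt (allFin q)))
    positions-unique = concat⁺ (ListAllₚ.map⁺ {f = positionsAt} (ListAll.tabulate λ {j} _ → positionsAt-unique j))
                               (AllPairsₚ.map⁺ (AllPairs.map positionsAt-disjoint (allFin⁺ q)))

  length-rooks : ∀ q → length (rooks (suc q)) ≡ suc q * (n ^ ℓ-1 * (n ^ ℓ-1 * n-1) ^ q * n ^ r)
  length-rooks q =
    trans (length-concat-map rooksAt length-rooksAt (allFin (suc q))) (cong (_* c) (length-allFin (suc q)))
    where
    c = n ^ ℓ-1 * (n ^ ℓ-1 * n-1) ^ q * n ^ r
    length-rooksAt : ∀ j → length (rooksAt j) ≡ c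
    length-rooksAt j = trans (length-map (rookAt j) (positionsAt j)) (length-positionsAt j)

  -- ℓ-1 + q * ℓ + r is (suc q * ℓ + r) ∸ 1 by computation.
  rooks-dense : ∀ q m → suc q * m * q ≤ n-1 →
                suc q * m * n ^ (ℓ-1 + q * ℓ + r) ≤ m * length (rooks (suc q)) + n ^ (ℓ-1 + q * ℓ + r)
  rooks-dense q m n-1-large = begin
    G * n ^ (ℓ-1 + q * ℓ + r)                    ≡⟨ cong (G *_) volume ⟩
    G * (X * (n ^ q * X ^ q) * R)                ≡⟨ regroupˡ G X (n ^ q) (X ^ q) R ⟩
    G * n ^ q * (X * X ^ q * R)                  ≤⟨ *-monoˡ-≤ (X * X ^ q * R) (^-gap G n-1 q n-1-large) ⟩
    (G * n-1 ^ q + n ^ q) * (X * X ^ q * R)      ≡⟨ regroupʳ (suc q) m X (n-1 ^ q) (n ^ q) (X ^ q) R ⟩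
    m * (suc q * (X * (X ^ q * n-1 ^ q) * R)) + X * (n ^ q * X ^ q) * R
      ≡⟨ cong₂ (λ a b → m * (suc q * (X * a * R)) + b) (^-distrib-* X n-1 q) volume ⟨
    m * (suc q * (X * (X * n-1) ^ q * R)) + n ^ (ℓ-1 + q * ℓ + r)
      ≡⟨ cong (λ l → m * l + n ^ (ℓ-1 + q * ℓ + r)) (length-rooks q) ⟨
    m * length (rooks (suc q)) + n ^ (ℓ-1 + q * ℓ + r) ∎
    where
    open ≤-Reasoning
    G = suc q * m
    X = n ^ ℓ-1
    R = n ^ r
    volume : n ^ (ℓ-1 + q * ℓ + r) ≡ X * (n ^ q * X ^ q) * R
    volume = begin-equality
      n ^ (ℓ-1 + q * ℓ + r)         ≡⟨ ^-distribˡ-+-* n (ℓ-1 + q * ℓ) r ⟩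
      n ^ (ℓ-1 + q * ℓ) * R         ≡⟨ cong (_* R) (^-distribˡ-+-* n ℓ-1 (q * ℓ)) ⟩
      X * n ^ (q * ℓ) * R           ≡⟨ cong (λ e → X * n ^ e * R) (*-comm q ℓ) ⟩
      X * n ^ (ℓ * q) * R           ≡⟨ cong (λ a → X * a * R) (^-*-assoc n ℓ q) ⟨
      X * (n * X) ^ q * R           ≡⟨ cong (λ a → X * a * R) (^-distrib-* n X q) ⟩
      X * (n ^ q * X ^ q) * R       ∎
    regroupˡ : ∀ g x a b y → g * (x * (a * b) * y) ≡ g * a * (x * b * y)
    regroupˡ = solve-∀
    regroupʳ : ∀ Q m x a b c y → (Q * m * a + b) * (x * c * y) ≡ m * (Q * (x * (c * a) * y)) + x * (b * c) * y
    regroupʳ = solve-∀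

-- Eventually b_{n,k,ℓ} ≥ (q - 1/m) n^(k-1); for all m this says b_{k,ℓ} ≥ q.
DensityAtLeast : ℕ → ℕ → ℕ → ℕ → Set
DensityAtLeast k ℓ q m = Σ ℕ λ N → (n : ℕ) → N ≤ n →
  Σ (List (Rook n k ℓ)) λ rs → NonAttacking rs × (q * m * n ^ (k ∸ 1) ≤ m * length rs + n ^ (k ∸ 1))

blockCode-dense : ∀ q ℓ r m .{{_ : NonZero q}} .{{_ : NonZero ℓ}} → DensityAtLeast (q * ℓ + r) ℓ q m
blockCode-dense (suc q) (suc ℓ-1) r m = suc (suc q * m * q) , λ where
  (suc n-1) (s≤s n-1-large) → let open BlockCode n-1 ℓ-1 r in
    rooks (suc q) , rooks-nonAttacking (suc q) , rooks-dense q m n-1-large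

corollary19 : (k ℓ : ℕ) .{{_ : NonZero ℓ}} → ℓ ≤ k →
    (m : ℕ) .{{_ : NonZero m}} →
    Σ ℕ λ N → (n : ℕ) → N ≤ n →
      Σ (List (Rook n k ℓ)) λ rs → NonAttacking rs ×
        ((k / ℓ) * m * n ^ (k ∸ 1) ≤ m * length rs + n ^ (k ∸ 1))
corollary19 k ℓ ℓ≤k m = subst (λ k′ → DensityAtLeast k′ ℓ (k / ℓ) m) (sym k≡[k/ℓ]*ℓ+k%ℓ)
  (blockCode-dense (k / ℓ) ℓ (k % ℓ) m {{>-nonZero (m≥n⇒m/n>0 ℓ≤k)}})
  where
  k≡[k/ℓ]*ℓ+k%ℓ : k ≡ k / ℓ * ℓ + k % ℓ
  k≡[k/ℓ]*ℓ+k%ℓ = trans (m≡m%n+[m/n]*n k ℓ) (+-comm (k % ℓ) (k / ℓ * ℓ))
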